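{- For Boolean kits $\underline{\mathbb{A}},\underline{\mathbb{B}},\underline{\mathbb{C}}$, the Boolean kits $(\underline{\mathbb{A}}\otimes\underline{\mathbb{B}})\multimap\underline{\mathbb{C}}$ and $\underline{\mathbb{A}}\multimap(\underline{\mathbb{B}}\multimap\underline{\mathbb{C}})$ are isomorphic.
   Context: A kit on a groupoid $\mathbb{A}$ is a family $\mathcal{A}(a)$ of sets of subgroups of $\mathrm{End}(a)=\mathbb{A}(a,a)$ closed under conjugation. Subgroups $H,K$ of $\mathrm{End}(a)$ are orthogonal if $H\cap K=\{\mathrm{id}\}$; for a family $\mathcal{K}$ of sets of subgroups, $\mathcal{K}^\perp(a)$ is the set of subgroups orthogonal to all members of $\mathcal{K}(a)$. A kit is Boolean if $\mathcal{A}=\mathcal{A}^{\perp\perp}$. $\bigcup\mathcal{A}(a)$ is the union of members. Tensor: $(\mathbb{A},\mathcal{A})\otimes(\mathbb{B},\mathcal{B})=(\mathbb{A}\times\mathbb{B},(\mathcal{A}\times\mathcal{B})^{\perp\perp})$ with $(\mathcal{A}\times\mathcal{B})(a,b)=\{H\times K:H\in\mathcal{A}(a),K\in\mathcal{B}(b)\}$. Linear arrow: $(\mathbb{A},\mathcal{A})\multimap(\mathbb{B},\mathcal{B})=(\mathbb{A}^{op}\times\mathbb{B},\mathcal{A}\multimap\mathcal{B})$, where $(\mathcal{A}\multimap\mathcal{B})(a,b)$ is the set of subgroups $H\le\mathrm{End}(a,b)$ such that for all $(\alpha,\beta)\in H$, $\alpha\in\bigcup\mathcal{A}(a)\Rightarrow\beta\in\bigcup\mathcal{B}(b)$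 and $\beta\in\bigcup\mathcal{B}^\perp(b)\Rightarrow\alpha\in\bigcup\mathcal{A}^\perp(a)$. Isomorphism of kits means an isomorphism of the underlying groupoids (here the canonical one $(\mathbb{A}\times\mathbb{B})^{op}\times\mathbb{C}\cong\mathbb{A}^{op}\times(\mathbb{B}^{op}\times\mathbb{C})$) carrying one kit onto the other. -}

module Defs where

open import Level using (Level; _⊔_) renaming (suc to lsuc)
open import Data.Product using (Σ; Σ-syntax; _×_; _,_; proj₁; proj₂)
open import Relation.Binary.PropositionalEquality using (_≡_)

_⇔_ : ∀ {a b} → Set a → Set b → Set (a ⊔ b)
A ⇔ B = (A → B) × (B → A)

record Groupoid (o ℓ : Level) : Set (lsuc (o ⊔ ℓ)) where
  infixr 9 _∘_
  field
    Obj   : Set o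
    Hom   : Obj → Obj → Set ℓ
    _∘_   : ∀ {a b c} → Hom b c → Hom a b → Hom a c
    id    : ∀ {a} → Hom a a
    inv   : ∀ {a b} → Hom a b → Hom b a
    assoc : ∀ {a b c d} (h : Hom c d) (g : Hom b c) (f : Hom a b) →
            (h ∘ g) ∘ f ≡ h ∘ (g ∘ f)
    idˡ   : ∀ {a b} (f : Hom a b) → id ∘ f ≡ f
    idʳ   : ∀ {a b} (f : Hom a b) → f ∘ id ≡ f
    invˡ  : ∀ {a b} (f : Hom a b) → inv f ∘ f ≡ id
    invʳ  : ∀ {a b} (f : Hom a b) → f ∘ inv f ≡ id

  End : Obj → Set ℓ
  End a = Hom a a

open Groupoid

op : ∀ {o ℓ} → Groupoid o ℓ → Groupoid o ℓ
op G = record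
  { Obj = Obj G
  ; Hom = λ a b → Hom G b a
  ; _∘_ = λ g f → _∘_ G f g
  ; id = id G
  ; inv = inv G
  ; assoc = λ h g f → Relation.Binary.PropositionalEquality.sym (assoc G f g h)
  ; idˡ = idʳ G
  ; idʳ = idˡ G
  ; invˡ = invʳ G
  ; invʳ = invˡ G
  }
  where import Relation.Binary.PropositionalEquality

_⊠_ : ∀ {o ℓ} → Groupoid o ℓ → Groupoid o ℓ → Groupoid o ℓ
G ⊠ H = record
  { Obj = Obj G × Obj H
  ; Hom = λ x y → Hom G (proj₁ x) (proj₁ y) × Hom H (proj₂ x) (proj₂ y)
  ; _∘_ = λ g f → (_∘_ G (proj₁ g) (proj₁ f) , _∘_ H (proj₂ g) (proj₂ f))
  ; id = (id G , id H)
  ; inv = λ f → (inv G (proj₁ f) , inv H (proj₂ f))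
  ; assoc = λ h g f → cong₂ _,_ (assoc G _ _ _) (assoc H _ _ _)
  ; idˡ = λ f → cong₂ _,_ (idˡ G _) (idˡ H _)
  ; idʳ = λ f → cong₂ _,_ (idʳ G _) (idʳ H _)
  ; invˡ = λ f → cong₂ _,_ (invˡ G _) (invˡ H _)
  ; invʳ = λ f → cong₂ _,_ (invʳ G _) (invʳ H _)
  }
  where open import Relation.Binary.PropositionalEquality using (cong₂)

record Subgroup {o ℓ} (G : Groupoid o ℓ) (a : Obj G) : Set (lsuc ℓ) where
  field
    mem    : End G a → Set ℓ
    id-mem : mem (id G)
    ∘-mem  : ∀ {g h} → mem g → mem h → mem (_∘_ G g h)
    inv-mem : ∀ {g} → mem g → mem (inv G g)

open Subgroup public

SubgroupSet : ∀ {o ℓ} (G : Groupoid o ℓ) → Obj G → Set (lsuc (lsuc ℓ))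
SubgroupSet {ℓ = ℓ} G a = Subgroup G a → Set (lsuc ℓ)

Family : ∀ {o ℓ} (G : Groupoid o ℓ) → Set (o ⊔ lsuc (lsuc ℓ))
Family G = ∀ a → SubgroupSet G a

IsConjugate : ∀ {o ℓ} (G : Groupoid o ℓ) {a b : Obj G} (f : Hom G a b) →
              Subgroup G a → Subgroup G b → Set ℓ
IsConjugate G f H K =
  ∀ g → mem K g ⇔ mem H (_∘_ G (inv G f) (_∘_ G g f))

record Kit {o ℓ} (G : Groupoid o ℓ) : Set (o ⊔ lsuc (lsuc ℓ)) where
  field
    fam     : Family G
    conjugation-closed : ∀ {a b} (f : Hom G a b) (H : Subgroup G a) (K : Subgroup G b) →
                         IsConjugate G f H K → fam a H → fam b K

open Kit public

Orthogonal : ∀ {o ℓ} {G : Groupoid o ℓ} {a : Obj G} → Subgroup G a → Subgroup G a → Set ℓ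
Orthogonal {G = G} H K = ∀ g → mem H g → mem K g → g ≡ id G

_ᗮ : ∀ {o ℓ} {G : Groupoid o ℓ} → Family G → Family G
(𝒦 ᗮ) a H = ∀ K → 𝒦 a K → Orthogonal H K

_≐_ : ∀ {o ℓ} {G : Groupoid o ℓ} → Family G → Family G → Set (o ⊔ lsuc ℓ)
𝒜 ≐ ℬ = ∀ a H → 𝒜 a H ⇔ ℬ a H

IsBoolean : ∀ {o ℓ} {G : Groupoid o ℓ} → Kit G → Set (o ⊔ lsuc ℓ)
IsBoolean 𝒜 = fam 𝒜 ≐ ((fam 𝒜 ᗮ) ᗮ)

⋃ : ∀ {o ℓ} {G : Groupoid o ℓ} → Family G → (a : Obj G) → End G a → Set (lsuc ℓ)
⋃ 𝒜 a g = Σ[ H ∈ Subgroup _ a ] (𝒜 a H × mem H g)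

-- (𝒜 × ℬ)(a,b) = { H × K }, with L = H × K meaning mem L (α,β) ⇔ mem H α × mem K β
_×ᶠ_ : ∀ {o ℓ} {A B : Groupoid o ℓ} → Family A → Family B → Family (A ⊠ B)
(_×ᶠ_ {A = A} {B} 𝒜 ℬ) (a , b) L =
  Σ[ H ∈ Subgroup A a ] Σ[ K ∈ Subgroup B b ]
    (𝒜 a H × ℬ b K × (∀ α β → mem L (α , β) ⇔ (mem H α × mem K β)))

_⊗ᶠ_ : ∀ {o ℓ} {A B : Groupoid o ℓ} → Family A → Family B → Family (A ⊠ B)
𝒜 ⊗ᶠ ℬ = ((𝒜 ×ᶠ ℬ) ᗮ) ᗮ

-- (𝒜 ⊸ ℬ)(a,b) on the groupoid A^op × B
-- (End_{A^op}(a) has the same underlying set as End_A(a))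
_⊸ᶠ_ : ∀ {o ℓ} {A B : Groupoid o ℓ} → Family A → Family B → Family (op A ⊠ B)
(𝒜 ⊸ᶠ ℬ) (a , b) H =
  ∀ α β → mem H (α , β) →
    ((⋃ 𝒜 a α → ⋃ ℬ b β) × (⋃ (ℬ ᗮ) b β → ⋃ (𝒜 ᗮ) a α))

-- The canonical isomorphism (A × B)^op × C ≅ A^op × (B^op × C),
-- ((a,b),c) ↦ (a,(b,c)),  ((α,β),γ) ↦ (α,(β,γ)), acting on subgroups.

module _ {o ℓ} {A B C : Groupoid o ℓ} where

  L-grp R-grp : Groupoid o ℓ
  L-grp = op (A ⊠ B) ⊠ C
  R-grp = op A ⊠ (op B ⊠ C)

  φ-sub : ∀ {a b c} → Subgroup L-grp ((a , b) , c) → Subgroup R-grp (a , (b , c))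
  φ-sub H = record
    { mem = λ { (α , (β , γ)) → mem H ((α , β) , γ) }
    ; id-mem = id-mem H
    ; ∘-mem = λ p q → ∘-mem H p q
    ; inv-mem = λ p → inv-mem H p
    }

  φ⁻¹-sub : ∀ {a b c} → Subgroup R-grp (a , (b , c)) → Subgroup L-grp ((a , b) , c)
  φ⁻¹-sub H = record
    { mem = λ { ((α , β) , γ) → mem H (α , (β , γ)) }
    ; id-mem = id-mem H
    ; ∘-mem = λ p q → ∘-mem H p q
    ; inv-mem = λ p → inv-mem H p
    }

  CarriesOnto : Family L-grp → Family R-grp → Set (o ⊔ lsuc ℓ)
  CarriesOnto 𝒦₁ 𝒦₂ =
    (∀ a b c (H : Subgroup L-grp ((a , b) , c)) →
       𝒦₁ ((a , b) , c) H → 𝒦₂ (a , (b , c)) (φ-sub H)) ×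
    (∀ a b c (H : Subgroup R-grp (a , (b , c))) →
       𝒦₂ (a , (b , c)) H → 𝒦₁ ((a , b) , c) (φ⁻¹-sub H))

module Submission where

open import Level using (Level)
open import Data.Product using (Σ; _×_; _,_; proj₁; proj₂)
open import Relation.Binary.PropositionalEquality using (_≡_; refl; sym; trans; cong; cong₂; subst)
open import Defs

-- Both directions test a subgroup H of End(a) × End(b) × End(c) through its images.
-- Forward, the image of H over G ∈ 𝒜 is a subgroup of End(b) × End(c) lying in
-- ℬ ⊸ 𝒞; backward, the image of H over D ∈ 𝒞ᗮ is a subgroup of End(a) × End(b)
-- orthogonal to every G × K, hence in (𝒜 ⊗ ℬ)ᗮ. Each orthogonality claim reduces,
-- via the two clauses of ⊸, to an element lying both in ⋃𝒦 and in ⋃𝒦ᗮ, which must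
-- be the identity.

open Groupoid

private
  variable
    o ℓ : Level

trivial : (G : Groupoid o ℓ) (a : Obj G) → Subgroup G a
trivial G a = record { mem = λ g → g ≡ id G ; id-mem = refl ; ∘-mem = ∘-id ; inv-mem = inv-id }
  where
  ∘-id : ∀ {g h} → g ≡ id G → h ≡ id G → _∘_ G g h ≡ id G
  ∘-id refl refl = idˡ G (id G)

  inv-id : ∀ {g} → g ≡ id G → inv G g ≡ id G
  inv-id refl = trans (sym (idʳ G (inv G (id G)))) (invˡ G (id G))

module _ {G : Groupoid o ℓ} {a : Obj G} where

  opˢ : Subgroup G a → Subgroup (op G) a
  opˢ H = record { mem = mem H ; id-mem = id-mem H ; ∘-mem = λ p q → ∘-mem H q p ; inv-mem = inv-mem H }

  unopˢ : Subgroup (op G) a → Subgroup G a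
  unopˢ H = record { mem = mem H ; id-mem = id-mem H ; ∘-mem = λ p q → ∘-mem H q p ; inv-mem = inv-mem H }

  trivial-orthogonal : (K : Subgroup G a) → Orthogonal (trivial G a) K
  trivial-orthogonal K g g≡id _ = g≡id

module _ {G : Groupoid o ℓ} (𝒦 : Family G) where

  ⊆ᗮᗮ : ∀ {a} (H : Subgroup G a) → 𝒦 a H → ((𝒦 ᗮ) ᗮ) a H
  ⊆ᗮᗮ H H∈ K K∈ g g∈H g∈K = K∈ _ H∈ g g∈K g∈H

  ᗮᗮᗮ⊆ᗮ : ∀ {a} (H : Subgroup G a) → (((𝒦 ᗮ) ᗮ) ᗮ) a H → (𝒦 ᗮ) a H
  ᗮᗮᗮ⊆ᗮ H H∈ K K∈ = H∈ K (⊆ᗮᗮ K K∈)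

  trivial∈ᗮ : ∀ a → (𝒦 ᗮ) a (trivial G a)
  trivial∈ᗮ a K _ = trivial-orthogonal K

  id∈⋃ : ∀ {a} → 𝒦 a (trivial G a) → ⋃ 𝒦 a (id G)
  id∈⋃ {a} t = trivial G a , t , refl

  ⋃∧⋃ᗮ⇒≡id : ∀ {a g} → ⋃ 𝒦 a g → ⋃ (𝒦 ᗮ) a g → g ≡ id G
  ⋃∧⋃ᗮ⇒≡id (K , K∈ , g∈K) (X , X∈ , g∈X) = X∈ K K∈ _ g∈X g∈K

trivial∈Boolean : {G : Groupoid o ℓ} (𝒦 : Kit G) → IsBoolean 𝒦 → ∀ a → fam 𝒦 a (trivial G a)
trivial∈Boolean {G = G} 𝒦 boolean a = proj₂ (boolean a (trivial G a)) (λ K _ → trivial-orthogonal K)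

module _ {P Q : Groupoid o ℓ} {x : Obj P} {y : Obj Q} where

  _×ˢ_ : Subgroup P x → Subgroup Q y → Subgroup (P ⊠ Q) (x , y)
  G ×ˢ K = record
    { mem = λ (α , β) → mem G α × mem K β
    ; id-mem = id-mem G , id-mem K
    ; ∘-mem = λ (g , k) (g′ , k′) → ∘-mem G g g′ , ∘-mem K k k′
    ; inv-mem = λ (g , k) → inv-mem G g , inv-mem K k
    }

  image₁ : Subgroup (P ⊠ Q) (x , y) → Subgroup Q y → Subgroup P x
  image₁ S T = record
    { mem = λ α → Σ (End Q y) λ β → mem T β × mem S (α , β)
    ; id-mem = id Q , id-mem T , id-mem S
    ; ∘-mem = λ (β , t , s) (β′ , t′ , s′) → _∘_ Q β β′ , ∘-mem T t t′ , ∘-mem S s s′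
    ; inv-mem = λ (β , t , s) → inv Q β , inv-mem T t , inv-mem S s
    }

  image₂ : Subgroup (P ⊠ Q) (x , y) → Subgroup P x → Subgroup Q y
  image₂ S T = record
    { mem = λ β → Σ (End P x) λ α → mem T α × mem S (α , β)
    ; id-mem = id P , id-mem T , id-mem S
    ; ∘-mem = λ (α , t , s) (α′ , t′ , s′) → _∘_ P α α′ , ∘-mem T t t′ , ∘-mem S s s′
    ; inv-mem = λ (α , t , s) → inv P α , inv-mem T t , inv-mem S s
    }

  module _ (𝒜 : Family P) (ℬ : Family Q) {G : Subgroup P x} {K : Subgroup Q y} where

    ×ˢ∈×ᶠ : 𝒜 x G → ℬ y K → (𝒜 ×ᶠ ℬ) (x , y) (G ×ˢ K)
    ×ˢ∈×ᶠ G∈ K∈ = G , K , G∈ , K∈ , λ _ _ → (λ p → p) , (λ p → p)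

    ×ˢ∈⊗ᶠ : 𝒜 x G → ℬ y K → (𝒜 ⊗ᶠ ℬ) (x , y) (G ×ˢ K)
    ×ˢ∈⊗ᶠ G∈ K∈ = ⊆ᗮᗮ (𝒜 ×ᶠ ℬ) (G ×ˢ K) (×ˢ∈×ᶠ G∈ K∈)

    ×ᶠᗮ-meets-×ˢ : ∀ (M : Subgroup (P ⊠ Q) (x , y)) {α β} →
                   𝒜 x G → ℬ y K → ((𝒜 ×ᶠ ℬ) ᗮ) (x , y) M →
                   mem M (α , β) → mem G α → mem K β → (α , β) ≡ (id P , id Q)
    ×ᶠᗮ-meets-×ˢ M G∈ K∈ M∈ αβ∈M α∈G β∈K = M∈ (G ×ˢ K) (×ˢ∈×ᶠ G∈ K∈) _ αβ∈M (α∈G , β∈K)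

  image₂∈ᗮ : ∀ (𝒜 : Family P) (ℬ : Family Q) {G} M → 𝒜 x G →
             ((𝒜 ×ᶠ ℬ) ᗮ) (x , y) M → (ℬ ᗮ) y (image₂ M G)
  image₂∈ᗮ 𝒜 ℬ M G∈ M∈ K K∈ β (α , α∈G , αβ∈M) β∈K =
    cong proj₂ (×ᶠᗮ-meets-×ˢ 𝒜 ℬ M G∈ K∈ M∈ αβ∈M α∈G β∈K)

module _ {A B : Groupoid o ℓ} (𝒜 : Family A) (ℬ : Family B)
         {a : Obj A} {b : Obj B} (H : Subgroup (op A ⊠ B) (a , b))
         (H∈ : (𝒜 ⊸ᶠ ℬ) (a , b) H) {α β} (αβ∈H : mem H (α , β)) where

  ⊸-preserves-⋃ : ⋃ 𝒜 a α → ⋃ ℬ b β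
  ⊸-preserves-⋃ = proj₁ (H∈ α β αβ∈H)

  ⊸-reflects-⋃ᗮ : ⋃ (ℬ ᗮ) b β → ⋃ (𝒜 ᗮ) a α
  ⊸-reflects-⋃ᗮ = proj₂ (H∈ α β αβ∈H)

trivial×ˢᗮ∈⊸ᶠᗮ : {B C : Groupoid o ℓ} (ℬ : Family B) (𝒞 : Family C)
                 {b : Obj B} {c : Obj C}
                 (D : Subgroup C c) → ℬ b (trivial B b) → (𝒞 ᗮ) c D →
                 ((ℬ ⊸ᶠ 𝒞) ᗮ) (b , c) (trivial (op B) b ×ˢ D)
trivial×ˢᗮ∈⊸ᶠᗮ {B = B} ℬ 𝒞 {b} {c} D ℬ-trivial D∈ K K∈ (β , γ) (refl , γ∈D) βγ∈K =
  cong (id B ,_) (⋃∧⋃ᗮ⇒≡id 𝒞 (⊸-preserves-⋃ ℬ 𝒞 K K∈ βγ∈K (id∈⋃ ℬ ℬ-trivial)) (D , D∈ , γ∈D))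

module Curry {A B C : Groupoid o ℓ} (𝒜 : Family A) (ℬ : Family B) (𝒞 : Family C)
             (ℬ-trivial : ∀ b → ℬ b (trivial B b))
             {a b c} (H : Subgroup L-grp ((a , b) , c))
             (H∈ : ((𝒜 ⊗ᶠ ℬ) ⊸ᶠ 𝒞) ((a , b) , c) H) where

  fibre : Subgroup A a → Subgroup (op B ⊠ C) (b , c)
  fibre G = image₂ (φ-sub H) (opˢ G)

  fibre∈⊸ᶠ : ∀ {G} → 𝒜 a G → (ℬ ⊸ᶠ 𝒞) (b , c) (fibre G)
  fibre∈⊸ᶠ {G} G∈ β γ (α , α∈G , h) = preserves , reflects
    where
    preserves : ⋃ ℬ b β → ⋃ 𝒞 c γ
    preserves (K , K∈ , β∈K) =
      ⊸-preserves-⋃ (𝒜 ⊗ᶠ ℬ) 𝒞 H H∈ h (G ×ˢ K , ×ˢ∈⊗ᶠ 𝒜 ℬ G∈ K∈ , α∈G , β∈K)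

    reflects : ⋃ (𝒞 ᗮ) c γ → ⋃ (ℬ ᗮ) b β
    reflects γ⊥ with ⊸-reflects-⋃ᗮ (𝒜 ⊗ᶠ ℬ) 𝒞 H H∈ h γ⊥
    ... | M , M∈ , αβ∈M =
      image₂ M G , image₂∈ᗮ 𝒜 ℬ M G∈ (ᗮᗮᗮ⊆ᗮ (𝒜 ×ᶠ ℬ) M M∈) , α , α∈G , αβ∈M

  cofibre∈ᗮ : ∀ P → ((ℬ ⊸ᶠ 𝒞) ᗮ) (b , c) P → (𝒜 ᗮ) a (unopˢ (image₁ (φ-sub H) P))
  -- P ⊥ fibre G forces (β , γ) = id, so (α , id) lies in some M ⊥ G × 1.
  cofibre∈ᗮ P P∈ G G∈ α ((β , γ) , βγ∈P , h) α∈G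
    with P∈ (fibre G) (fibre∈⊸ᶠ G∈) (β , γ) βγ∈P (α , α∈G , h)
  ... | refl with ⊸-reflects-⋃ᗮ (𝒜 ⊗ᶠ ℬ) 𝒞 H H∈ h (id∈⋃ (𝒞 ᗮ) (trivial∈ᗮ 𝒞 c))
  ...   | M , M∈ , αid∈M =
    cong proj₁ (×ᶠᗮ-meets-×ˢ 𝒜 ℬ M G∈ (ℬ-trivial b) (ᗮᗮᗮ⊆ᗮ (𝒜 ×ᶠ ℬ) M M∈) αid∈M α∈G refl)

  curry∈ : (𝒜 ⊸ᶠ (ℬ ⊸ᶠ 𝒞)) (a , (b , c)) (φ-sub H)
  curry∈ α (β , γ) h =
      (λ (G , G∈ , α∈G) → fibre G , fibre∈⊸ᶠ G∈ , α , α∈G , h)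
    , (λ (P , P∈ , βγ∈P) → unopˢ (image₁ (φ-sub H) P) , cofibre∈ᗮ P P∈ , (β , γ) , βγ∈P , h)

module Uncurry {A B C : Groupoid o ℓ} (𝒜 : Family A) (ℬ : Family B) (𝒞 : Family C)
               (𝒜-trivial : ∀ a → 𝒜 a (trivial A a))
               (ℬ-trivial : ∀ b → ℬ b (trivial B b))
               (𝒞-closed : ∀ {c D} → ((𝒞 ᗮ) ᗮ) c D → 𝒞 c D)
               {a b c} (H : Subgroup R-grp (a , (b , c)))
               (H∈ : (𝒜 ⊸ᶠ (ℬ ⊸ᶠ 𝒞)) (a , (b , c)) H) where

  cofibre : Subgroup C c → Subgroup (A ⊠ B) (a , b)
  cofibre D = unopˢ (image₁ (φ⁻¹-sub H) D)

  cofibre∈ᗮ : ∀ D → (𝒞 ᗮ) c D → ((𝒜 ×ᶠ ℬ) ᗮ) (a , b) (cofibre D)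
  cofibre∈ᗮ D D∈ L (G , K , G∈ , K∈ , L≅G×K) (α , β) (γ , γ∈D , h) αβ∈L =
    cong₂ _,_ α≡id β≡id
    where
    α∈G : mem G α
    α∈G = proj₁ (proj₁ (L≅G×K α β) αβ∈L)

    β≡id : β ≡ id B
    β≡id with ⊸-preserves-⋃ 𝒜 (ℬ ⊸ᶠ 𝒞) H H∈ h (G , G∈ , α∈G)
    ... | K′ , K′∈ , βγ∈K′ =
      ⋃∧⋃ᗮ⇒≡id ℬ (K , K∈ , proj₂ (proj₁ (L≅G×K α β) αβ∈L))
                 (⊸-reflects-⋃ᗮ ℬ 𝒞 K′ K′∈ βγ∈K′ (D , D∈ , γ∈D))

    α≡id : α ≡ id A
    α≡id = ⋃∧⋃ᗮ⇒≡id 𝒜 (G , G∈ , α∈G)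
      (⊸-reflects-⋃ᗮ 𝒜 (ℬ ⊸ᶠ 𝒞) H H∈ (subst (λ β′ → mem H (α , (β′ , γ))) β≡id h)
        (trivial (op B) b ×ˢ D , trivial×ˢᗮ∈⊸ᶠᗮ ℬ 𝒞 D (ℬ-trivial b) D∈ , refl , γ∈D))

  fibre∈ : ∀ M → (𝒜 ⊗ᶠ ℬ) (a , b) M → 𝒞 c (image₂ (φ⁻¹-sub H) (opˢ M))
  fibre∈ M M∈ = 𝒞-closed λ D D∈ γ ((α , β) , αβ∈M , h) γ∈D →
    let h₁ : mem H (id A , (id B , γ))
        h₁ = subst (λ (α′ , β′) → mem H (α′ , (β′ , γ)))
                   (M∈ (cofibre D) (cofibre∈ᗮ D D∈) (α , β) αβ∈M (γ , γ∈D , h)) h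
        K , K∈ , 1γ∈K = ⊸-preserves-⋃ 𝒜 (ℬ ⊸ᶠ 𝒞) H H∈ h₁ (id∈⋃ 𝒜 (𝒜-trivial a))
    in ⋃∧⋃ᗮ⇒≡id 𝒞 (⊸-preserves-⋃ ℬ 𝒞 K K∈ 1γ∈K (id∈⋃ ℬ (ℬ-trivial b))) (D , D∈ , γ∈D)

  uncurry∈ : ((𝒜 ⊗ᶠ ℬ) ⊸ᶠ 𝒞) ((a , b) , c) (φ⁻¹-sub H)
  uncurry∈ (α , β) γ h =
      (λ (M , M∈ , αβ∈M) → image₂ (φ⁻¹-sub H) (opˢ M) , fibre∈ M M∈ , (α , β) , αβ∈M , h)
    , (λ (D , D∈ , γ∈D) →
         cofibre D , ⊆ᗮᗮ ((𝒜 ×ᶠ ℬ) ᗮ) (cofibre D) (cofibre∈ᗮ D D∈) , γ , γ∈D , h)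

lemma5p6 : ∀ {o ℓ : Level} {A B C : Groupoid o ℓ}
             (𝒜 : Kit A) (ℬ : Kit B) (𝒞 : Kit C) →
             IsBoolean 𝒜 → IsBoolean ℬ → IsBoolean 𝒞 →
             CarriesOnto {A = A} {B} {C}
               ((fam 𝒜 ⊗ᶠ fam ℬ) ⊸ᶠ fam 𝒞)
               (fam 𝒜 ⊸ᶠ (fam ℬ ⊸ᶠ fam 𝒞))
lemma5p6 𝒜 ℬ 𝒞 𝒜-boolean ℬ-boolean 𝒞-boolean =
    (λ _ _ _ H H∈ → Curry.curry∈ (fam 𝒜) (fam ℬ) (fam 𝒞) ℬ-trivial H H∈)
  , (λ _ _ _ H H∈ →
       Uncurry.uncurry∈ (fam 𝒜) (fam ℬ) (fam 𝒞) 𝒜-trivial ℬ-trivial 𝒞-closed H H∈)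
  where
  𝒜-trivial : ∀ a → fam 𝒜 a (trivial _ a)
  𝒜-trivial = trivial∈Boolean 𝒜 𝒜-boolean

  ℬ-trivial : ∀ b → fam ℬ b (trivial _ b)
  ℬ-trivial = trivial∈Boolean ℬ ℬ-boolean

  𝒞-closed : ∀ {c D} → ((fam 𝒞 ᗮ) ᗮ) c D → fam 𝒞 c D
  𝒞-closed {c} {D} = proj₂ (𝒞-boolean c D)
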